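{- Let $M$ be a multigraph (without loops) with $n$ vertices. Then $M$ is the double competition multigraph of a loopless digraph if and only if there exist an ordering $(v_1,\ldots,v_n)$ of the vertices of $M$ and a double indexed edge clique partition $\{S_{ij}\mid i,j\in[n]\}$ of $M$ such that the following conditions hold: (I) for any $i,j\in[n]$, if $|A_i\cap B_j|\ge 2$, then $A_i\cap B_j=S_{ij}$; (II) for any $i,j\in[n]$, $v_i\notin S_{ij}$ and $v_j\notin S_{ij}$, where for $i,j\in[n]$, $A_i=S_{i*}\cup T^+_i$ with $S_{i*}:=\bigcup_{p\in[n]}S_{ip}$ and $T^+_i:=\{v_b\mid a,b\in[n],\ v_i\in S_{ab}\}$, and $B_j=S_{*j}\cup T^-_j$ with $S_{*j}:=\bigcup_{q\in[n]}S_{qj}$ and $T^-_j:=\{v_a\mid a,b\in[n],\ v_j\in S_{ab}\}$.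
   Context: A digraph $D$ consists of a vertex set $V(D)$ and a set $A(D)$ of ordered pairs of vertices (arcs); arcs $(v,v)$ are loops, and $D$ is loopless if it has no loops. $N^+_D(x)=\{v\mid (x,v)\in A(D)\}$ and $N^-_D(x)=\{v\mid (v,x)\in A(D)\}$. A multigraph $M$ is a vertex set $V(M)$ together with a function $m_M$ assigning to each unordered pair $\{x,y\}$ of distinct vertices a nonnegative integer (the number of edges between $x$ and $y$); multigraphs have no loops. The double competition multigraph of a digraph $D$ is the multigraph $M$ with $V(M)=V(D)$ and $m_M(\{x,y\})=|N^+_D(x)\cap N^+_D(y)|\cdot|N^-_D(x)\cap N^-_D(y)|$ for distinct $x,y$. A clique of $M$ is a set of vertices that are pairwise adjacent (i.e. $m_M\ge 1$ for each pair of distinct members); the empty set (and any single vertex) counts as a clique. An edge clique partition of $M$ is a family (multiset) $\mathcal F$ of cliques of $M$ such that any two distinct vertices $x,y$ are contained together in exactly $m_M(\{x,y\})$ members of $\mathcal F$. A double indexed edge clique partition $\{S_{ij}\mid i,j\in[n]\}$ is such a family indexed by pairs in $[n]\times[n]$, where $[n]=\{1,\ldots,n\}$. -}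

module Defs where

open import Data.Nat using (ℕ; _*_; _≤_)
open import Data.Bool using (Bool; true; false; _∧_)
open import Data.Fin using (Fin)
open import Data.Fin.Properties using (any?) renaming (_≟_ to _≟F_)
open import Data.Fin.Subset using (Subset; _∈_; _∉_; _∩_; _∪_; ∣_∣)
open import Data.Fin.Subset.Properties using (_∈?_)
open import Data.Vec using (tabulate; lookup)
open import Data.Vec using (sum)
open import Data.Product using (_×_; Σ; ∃)
open import Relation.Nullary.Decidable using (⌊_⌋; _×-dec_)
open import Relation.Binary.PropositionalEquality using (_≡_; _≢_)
open import Function.Definitions using (Bijective)

-- A loopless multigraph on vertex set Fin n: m x y = number of edges between x and y.
-- Only the values at distinct x, y are meaningful; m must be symmetric.
Multigraph : ℕ → Set
Multigraph n = Fin n → Fin n → ℕ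

IsSymmetric : ∀ {n} → Multigraph n → Set
IsSymmetric m = ∀ x y → m x y ≡ m y x

Digraph : ℕ → Set
Digraph n = Fin n → Fin n → Bool

Loopless : ∀ {n} → Digraph n → Set
Loopless D = ∀ x → D x x ≡ false

N⁺ : ∀ {n} → Digraph n → Fin n → Subset n
N⁺ D x = tabulate (λ v → D x v)

N⁻ : ∀ {n} → Digraph n → Fin n → Subset n
N⁻ D x = tabulate (λ v → D v x)

IsDoubleCompetitionMultigraphOf : ∀ {n} → Multigraph n → Digraph n → Set
IsDoubleCompetitionMultigraphOf m D =
  ∀ x y → x ≢ y → m x y ≡ ∣ N⁺ D x ∩ N⁺ D y ∣ * ∣ N⁻ D x ∩ N⁻ D y ∣

IsClique : ∀ {n} → Multigraph n → Subset n → Set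
IsClique m S = ∀ x y → x ∈ S → y ∈ S → x ≢ y → 1 ≤ m x y

pairCount : ∀ {n} → (Fin n → Fin n → Subset n) → Fin n → Fin n → ℕ
pairCount S x y =
  sum (tabulate (λ i → ∣ tabulate (λ j → lookup (S i j) x ∧ lookup (S i j) y) ∣))

IsDoubleIndexedECP : ∀ {n} → Multigraph n → (Fin n → Fin n → Subset n) → Set
IsDoubleIndexedECP m S =
  (∀ i j → IsClique m (S i j)) × (∀ x y → x ≢ y → pairCount S x y ≡ m x y)

module _ {n : ℕ} (v : Fin n → Fin n) (S : Fin n → Fin n → Subset n) where

  Srow : Fin n → Subset n
  Srow i = tabulate (λ w → ⌊ any? (λ p → w ∈? S i p) ⌋)

  Scol : Fin n → Subset n
  Scol j = tabulate (λ w → ⌊ any? (λ q → w ∈? S q j) ⌋)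

  T⁺ : Fin n → Subset n
  T⁺ i = tabulate (λ w → ⌊ any? (λ a → any? (λ b → (v b ≟F w) ×-dec (v i ∈? S a b))) ⌋)

  T⁻ : Fin n → Subset n
  T⁻ j = tabulate (λ w → ⌊ any? (λ a → any? (λ b → (v a ≟F w) ×-dec (v j ∈? S a b))) ⌋)

  A : Fin n → Subset n
  A i = Srow i ∪ T⁺ i

  B : Fin n → Subset n
  B j = Scol j ∪ T⁻ j

  ConditionI : Set
  ConditionI = ∀ i j → 2 ≤ ∣ A i ∩ B j ∣ → A i ∩ B j ≡ S i j

  ConditionII : Set
  ConditionII = ∀ i j → (v i ∉ S i j) × (v j ∉ S i j)

module Submission where

-- (⇒) Given D, order the vertices trivially (v = id) and put
--     S_ab = { x | x → a and b → x }.  Then A_i is the in-neighbourhood of i,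
--     B_j the out-neighbourhood of j, so A_i ∩ B_j = S_ij (condition I);
--     looplessness gives condition II; and x, y lie together in
--     |N⁺x ∩ N⁺y| · |N⁻x ∩ N⁻y| of the sets S_ab, one for each choice of a
--     common out-neighbour a and common in-neighbour b.
-- (⇐) Given v and S, draw an arc x → v_i whenever x ∈ A_i.  Because v is
--     injective, v_j ∈ A_a iff v_a ∈ B_j, so the in-neighbours of v_j are
--     exactly B_j; condition II makes the digraph loopless.  Condition I shows
--     that two distinct vertices lie in S_ij iff both lie in A_i and in B_j,
--     so the partition counts |{i | x,y ∈ A_i}| · |{j | x,y ∈ B_j}|, which is
--     the double competition count after reindexing along the bijection v.

open import Defs
open import Data.Nat using (ℕ; zero; suc; _+_; _*_; _≤_; z≤n; s≤s)
open import Data.Nat.Properties using (≤-trans; *-mono-≤; +-0-commutativeMonoid)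
open import Data.Bool using (Bool; true; false; _∧_; if_then_else_)
open import Data.Bool.Properties using (∧-commutativeMonoid; ⇔→≡; ¬-not)
open import Algebra.Bundles using (CommutativeMonoid)
open import Algebra.Properties.CommutativeSemigroup (CommutativeMonoid.commutativeSemigroup ∧-commutativeMonoid) using (interchange)
open import Algebra.Properties.CommutativeMonoid.Sum +-0-commutativeMonoid using (sum-permute) renaming (sum to ∑)
open import Data.Fin using (Fin; zero; suc)
open import Data.Fin.Permutation using (Permutation′; _⟨$⟩ʳ_; _⟨$⟩ˡ_; inverseʳ; flip)
open import Data.Fin.Properties using (any?) renaming (_≟_ to _≟F_)
open import Data.Fin.Subset using (Subset; _∈_; _∉_; _⊆_; _∩_; _∪_; ∣_∣)
open import Data.Fin.Subset.Properties using (_∈?_; ⊆-antisym; x∈p∩q⁺; x∈p∩q⁻; x∈p∪q⁺; x∈p∪q⁻; x∈p∧x≢y⇒x∈p-y; x∈p⇒∣p-x∣<∣p∣)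
open import Data.Vec using (tabulate; lookup; sum; _∷_)
open import Data.Vec.Properties using (lookup∘tabulate; tabulate-cong; lookup-zipWith; []=⇒lookup; lookup⇒[]=)
open import Data.Product using (_×_; _,_; proj₁; proj₂; ∃; ∃₂; Σ-syntax)
import Data.Product as Product
open import Data.Product.Function.NonDependent.Propositional using (_×-⇔_)
open import Data.Sum using (_⊎_; inj₁; inj₂)
open import Data.Sum.Function.Propositional using (_⊎-⇔_)
open import Function using (_∘_)
open import Function.Bundles using (_⇔_; mk⇔; mk⤖; Equivalence)
open import Function.Construct.Composition using (_⇔-∘_)
open import Function.Construct.Symmetry using (⇔-sym)
open import Function.Definitions using (Bijective)
open import Function.Properties.Bijection using (⤖⇒↔)
open import Relation.Nullary using (Dec; yes; no; _×-dec_)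
open import Relation.Nullary.Decidable using (⌊_⌋)
open import Data.Empty using (⊥; ⊥-elim)
open import Relation.Binary.PropositionalEquality
  using (_≡_; _≢_; refl; sym; trans; cong; cong₂; subst; subst₂; module ≡-Reasoning)

open Equivalence using (to; from)

module _ {n : ℕ} where

  ∈⇔lookup : {x : Fin n} {p : Subset n} → x ∈ p ⇔ lookup p x ≡ true
  ∈⇔lookup {x} {p} = mk⇔ []=⇒lookup (lookup⇒[]= x p)

  ∈-tabulate : {f : Fin n → Bool} {x : Fin n} → x ∈ tabulate f ⇔ f x ≡ true
  ∈-tabulate {f} {x} = subst (λ b → x ∈ tabulate f ⇔ b ≡ true) (lookup∘tabulate f x) ∈⇔lookup

  lookup-≡ : {p q : Subset n} {x y : Fin n} → (x ∈ p ⇔ y ∈ q) → lookup p x ≡ lookup q y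
  lookup-≡ x∈p⇔y∈q = ⇔→≡ (∈⇔lookup ⇔-∘ (x∈p⇔y∈q ⇔-∘ ⇔-sym ∈⇔lookup))

  ∉⇒lookup≡false : {p : Subset n} {x : Fin n} → x ∉ p → lookup p x ≡ false
  ∉⇒lookup≡false x∉p = ¬-not (x∉p ∘ from ∈⇔lookup)

⌊⌋⇔ : {P : Set} (d : Dec P) → ⌊ d ⌋ ≡ true ⇔ P
⌊⌋⇔ (yes p) = mk⇔ (λ _ → p) (λ _ → refl)
⌊⌋⇔ (no ¬p) = mk⇔ (λ ()) (λ p → ⊥-elim (¬p p))

∈-tabulate-dec : ∀ {n} {P : Fin n → Set} (d : ∀ x → Dec (P x)) {x : Fin n} →
                 x ∈ tabulate (λ w → ⌊ d w ⌋) ⇔ P x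
∈-tabulate-dec d {x} = ⌊⌋⇔ (d x) ⇔-∘ ∈-tabulate

∈∪ : ∀ {n} {p q : Subset n} {x : Fin n} → x ∈ p ∪ q ⇔ (x ∈ p ⊎ x ∈ q)
∈∪ {p = p} {q} = mk⇔ (x∈p∪q⁻ p q) x∈p∪q⁺

∧≡true : ∀ {a b : Bool} → a ∧ b ≡ true ⇔ (a ≡ true × b ≡ true)
∧≡true {true} = mk⇔ (λ b≡true → refl , b≡true) proj₂
∧≡true {false} = mk⇔ (λ ()) (λ { (() , _) })

module _ {n : ℕ} where

  ∈⇒1≤∣p∣ : {p : Subset n} {x : Fin n} → x ∈ p → 1 ≤ ∣ p ∣
  ∈⇒1≤∣p∣ x∈p = ≤-trans (s≤s z≤n) (x∈p⇒∣p-x∣<∣p∣ x∈p)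

  distinct⇒2≤∣p∣ : {p : Subset n} {x y : Fin n} → x ≢ y → x ∈ p → y ∈ p → 2 ≤ ∣ p ∣
  distinct⇒2≤∣p∣ x≢y x∈p y∈p =
    ≤-trans (s≤s (∈⇒1≤∣p∣ (x∈p∧x≢y⇒x∈p-y y∈p (x≢y ∘ sym)))) (x∈p⇒∣p-x∣<∣p∣ x∈p)

tabulate-∩ : ∀ {n} (f g : Fin n → Bool) → tabulate f ∩ tabulate g ≡ tabulate (λ c → f c ∧ g c)
tabulate-∩ {zero} f g = refl
tabulate-∩ {suc n} f g = cong (f zero ∧ g zero ∷_) (tabulate-∩ (f ∘ suc) (g ∘ suc))

∣tabulate-false∣ : ∀ n → ∣ tabulate {n = n} (λ _ → false) ∣ ≡ 0
∣tabulate-false∣ zero = refl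
∣tabulate-false∣ (suc n) = ∣tabulate-false∣ n

sum-∣tabulate-∧∣ : ∀ {k l} (α : Fin k → Bool) (β : Fin l → Bool) →
  sum (tabulate (λ i → ∣ tabulate (λ j → α i ∧ β j) ∣)) ≡ ∣ tabulate α ∣ * ∣ tabulate β ∣
sum-∣tabulate-∧∣ {zero} α β = refl
sum-∣tabulate-∧∣ {suc k} {l} α β with α zero | sum-∣tabulate-∧∣ (α ∘ suc) β
... | true | rest = cong (∣ tabulate β ∣ +_) rest
... | false | rest rewrite ∣tabulate-false∣ l = rest

∣tabulate∣≡∑ : ∀ {n} (f : Fin n → Bool) → ∣ tabulate f ∣ ≡ ∑ (λ i → if f i then 1 else 0)
∣tabulate∣≡∑ {zero} f = refl
∣tabulate∣≡∑ {suc n} f with f zero | ∣tabulate∣≡∑ (f ∘ suc)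
... | true | rest = cong suc rest
... | false | rest = rest

∣tabulate∣-permute : ∀ {n} (π : Permutation′ n) (f : Fin n → Bool) →
                     ∣ tabulate (f ∘ (π ⟨$⟩ʳ_)) ∣ ≡ ∣ tabulate f ∣
∣tabulate∣-permute π f = begin
  ∣ tabulate (f ∘ (π ⟨$⟩ʳ_)) ∣                   ≡⟨ ∣tabulate∣≡∑ (f ∘ (π ⟨$⟩ʳ_)) ⟩
  ∑ (λ i → if f (π ⟨$⟩ʳ i) then 1 else 0)        ≡⟨ sum-permute (λ i → if f i then 1 else 0) π ⟨
  ∑ (λ i → if f i then 1 else 0)                 ≡⟨ ∣tabulate∣≡∑ f ⟨
  ∣ tabulate f ∣                                 ∎
  where open ≡-Reasoning

∣common-neighbours∣ : ∀ {n} (D : Digraph n) (x y : Fin n) →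
  ∣ N⁺ D x ∩ N⁺ D y ∣ * ∣ N⁻ D x ∩ N⁻ D y ∣
    ≡ ∣ tabulate (λ c → D x c ∧ D y c) ∣ * ∣ tabulate (λ c → D c x ∧ D c y) ∣
∣common-neighbours∣ D x y =
  cong₂ _*_ (cong ∣_∣ (tabulate-∩ (D x) (D y))) (cong ∣_∣ (tabulate-∩ (λ c → D c x) (λ c → D c y)))

module _ {n : ℕ} where

  both : Subset n → Fin n → Fin n → Bool
  both p x y = lookup p x ∧ lookup p y

  both-true : {p : Subset n} {x y : Fin n} → both p x y ≡ true ⇔ (x ∈ p × y ∈ p)
  both-true = ⇔-sym (∈⇔lookup ×-⇔ ∈⇔lookup) ⇔-∘ ∧≡true

  both-∩ : (p q : Subset n) (x y : Fin n) → both (p ∩ q) x y ≡ both p x y ∧ both q x y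
  both-∩ p q x y = begin
    lookup (p ∩ q) x ∧ lookup (p ∩ q) y
      ≡⟨ cong₂ _∧_ (lookup-zipWith _∧_ x p q) (lookup-zipWith _∧_ y p q) ⟩
    (lookup p x ∧ lookup q x) ∧ (lookup p y ∧ lookup q y)
      ≡⟨ interchange (lookup p x) (lookup q x) (lookup p y) (lookup q y) ⟩
    both p x y ∧ both q x y ∎
    where open ≡-Reasoning

  -- If P ⊇ S and P collapses to S as soon as it has two elements, then S and
  -- P contain the same pairs of distinct vertices.  (This is how condition I
  -- is used.)
  both-determined : {S P : Subset n} {x y : Fin n} → x ≢ y → S ⊆ P →
                    (2 ≤ ∣ P ∣ → P ≡ S) → both S x y ≡ both P x y
  both-determined {S} {P} {x} {y} x≢y S⊆P collapse = ⇔→≡ (mk⇔ widen narrow)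
    where
    widen : both S x y ≡ true → both P x y ≡ true
    widen = from both-true ∘ Product.map S⊆P S⊆P ∘ to both-true
    narrow : both P x y ≡ true → both S x y ≡ true
    narrow inP = subst (λ Q → both Q x y ≡ true) (collapse two) inP
      where
      two : 2 ≤ ∣ P ∣
      two = distinct⇒2≤∣p∣ x≢y (proj₁ (to (both-true {P}) inP)) (proj₂ (to (both-true {P}) inP))

  pairCount-product : (S : Fin n → Fin n → Subset n) {x y : Fin n} (α β : Fin n → Bool) →
                      (∀ i j → both (S i j) x y ≡ α i ∧ β j) →
                      pairCount S x y ≡ ∣ tabulate α ∣ * ∣ tabulate β ∣
  pairCount-product S α β factor =
    trans (cong sum (tabulate-cong (λ i → cong ∣_∣ (tabulate-cong (factor i)))))
          (sum-∣tabulate-∧∣ α β)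

module Rows {n : ℕ} (v : Fin n → Fin n) (S : Fin n → Fin n → Subset n) where

  ∈A : ∀ {i w} → w ∈ A v S i ⇔ ((∃ λ p → w ∈ S i p) ⊎ (∃₂ λ a b → v b ≡ w × v i ∈ S a b))
  ∈A {i} = (∈-tabulate-dec (λ w → any? (λ p → w ∈? S i p))
            ⊎-⇔ ∈-tabulate-dec (λ w → any? (λ a → any? (λ b → (v b ≟F w) ×-dec (v i ∈? S a b)))))
           ⇔-∘ ∈∪

  ∈B : ∀ {j w} → w ∈ B v S j ⇔ ((∃ λ q → w ∈ S q j) ⊎ (∃₂ λ a b → v a ≡ w × v j ∈ S a b))
  ∈B {j} = (∈-tabulate-dec (λ w → any? (λ q → w ∈? S q j))
            ⊎-⇔ ∈-tabulate-dec (λ w → any? (λ a → any? (λ b → (v a ≟F w) ×-dec (v j ∈? S a b)))))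
           ⇔-∘ ∈∪

  S⊆A∩B : ∀ {i j} → S i j ⊆ A v S i ∩ B v S j
  S⊆A∩B {i} {j} w∈S = x∈p∩q⁺ (from ∈A (inj₁ (j , w∈S)) , from ∈B (inj₁ (i , w∈S)))

module FromDigraph {n : ℕ} (D : Digraph n) where

  S : Fin n → Fin n → Subset n
  S a b = tabulate (λ x → D x a ∧ D b x)

  id : Fin n → Fin n
  id x = x

  open Rows id S

  ∈S : ∀ {a b x} → x ∈ S a b ⇔ (D x a ≡ true × D b x ≡ true)
  ∈S = ∧≡true ⇔-∘ ∈-tabulate

  A-in : ∀ {i w} → w ∈ A id S i → D w i ≡ true
  A-in w∈A with to ∈A w∈A
  ... | inj₁ (p , w∈S) = proj₁ (to ∈S w∈S)
  ... | inj₂ (a , b , refl , i∈S) = proj₂ (to ∈S i∈S)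

  B-out : ∀ {j w} → w ∈ B id S j → D j w ≡ true
  B-out w∈B with to ∈B w∈B
  ... | inj₁ (q , w∈S) = proj₂ (to ∈S w∈S)
  ... | inj₂ (a , b , refl , j∈S) = proj₁ (to ∈S j∈S)

  A∩B≡S : ∀ i j → A id S i ∩ B id S j ≡ S i j
  A∩B≡S i j = ⊆-antisym A∩B⊆S S⊆A∩B
    where
    A∩B⊆S : A id S i ∩ B id S j ⊆ S i j
    A∩B⊆S w∈A∩B = from ∈S (A-in (proj₁ w∈A∧B) , B-out (proj₂ w∈A∧B))
      where w∈A∧B = x∈p∩q⁻ (A id S i) (B id S j) w∈A∩B

  conditionII : Loopless D → ConditionII id S
  conditionII loopless i j = (λ i∈S → no-loop i (proj₁ (to ∈S i∈S)))
                           , (λ j∈S → no-loop j (proj₂ (to ∈S j∈S)))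
    where
    no-loop : ∀ x → D x x ≡ true → ⊥
    no-loop x loop with () ← trans (sym (loopless x)) loop

  module _ {m : Multigraph n} (dc : IsDoubleCompetitionMultigraphOf m D) where

    -- A pair in S_ab has the common out-neighbour a and common in-neighbour b.
    isClique : ∀ a b → IsClique m (S a b)
    isClique a b x y x∈S y∈S x≢y =
      subst (1 ≤_) (sym (dc x y x≢y)) (*-mono-≤ (∈⇒1≤∣p∣ a-common) (∈⇒1≤∣p∣ b-common))
      where
      a-common : a ∈ N⁺ D x ∩ N⁺ D y
      a-common = x∈p∩q⁺ (from ∈-tabulate (proj₁ (to ∈S x∈S)) , from ∈-tabulate (proj₁ (to ∈S y∈S)))
      b-common : b ∈ N⁻ D x ∩ N⁻ D y
      b-common = x∈p∩q⁺ (from ∈-tabulate (proj₂ (to ∈S x∈S)) , from ∈-tabulate (proj₂ (to ∈S y∈S)))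

    partition : ∀ x y → x ≢ y → pairCount S x y ≡ m x y
    partition x y x≢y = begin
      pairCount S x y
        ≡⟨ pairCount-product S (λ c → D x c ∧ D y c) (λ c → D c x ∧ D c y) factor ⟩
      ∣ tabulate (λ c → D x c ∧ D y c) ∣ * ∣ tabulate (λ c → D c x ∧ D c y) ∣
        ≡⟨ ∣common-neighbours∣ D x y ⟨
      ∣ N⁺ D x ∩ N⁺ D y ∣ * ∣ N⁻ D x ∩ N⁻ D y ∣
        ≡⟨ dc x y x≢y ⟨
      m x y ∎
      where
      open ≡-Reasoning
      factor : ∀ a b → both (S a b) x y ≡ (D x a ∧ D y a) ∧ (D b x ∧ D b y)
      factor a b = trans (cong₂ _∧_ (lookup∘tabulate _ x) (lookup∘tabulate _ y))
                         (interchange (D x a) (D b x) (D y a) (D b y))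

    realises : Loopless D →
      Σ[ v ∈ (Fin n → Fin n) ] Σ[ S ∈ (Fin n → Fin n → Subset n) ]
        (Bijective _≡_ _≡_ v × IsDoubleIndexedECP m S × ConditionI v S × ConditionII v S)
    realises loopless =
      id , S , ((λ eq → eq) , (λ y → y , λ eq → eq)) , (isClique , partition)
         , (λ i j _ → A∩B≡S i j) , conditionII loopless

module FromPartition {n : ℕ} (v : Fin n → Fin n) (S : Fin n → Fin n → Subset n)
                     (v-bij : Bijective _≡_ _≡_ v) where

  open Rows v S

  π : Permutation′ n
  π = ⤖⇒↔ (mk⤖ v-bij)

  u : Fin n → Fin n
  u = π ⟨$⟩ˡ_

  v∘u : ∀ y → v (u y) ≡ y
  v∘u y = inverseʳ π

  D : Digraph n
  D x y = lookup (A v S (u y)) x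

  -- Since v is injective, v_j ∈ A_a exactly when v_a ∈ B_j.
  A-B-duality : ∀ {a j} → v j ∈ A v S a ⇔ v a ∈ B v S j
  A-B-duality {a} {j} = mk⇔ A⇒B B⇒A
    where
    A⇒B : v j ∈ A v S a → v a ∈ B v S j
    A⇒B vj∈A with to ∈A vj∈A
    ... | inj₁ (p , vj∈S) = from ∈B (inj₂ (a , p , refl , vj∈S))
    ... | inj₂ (c , b , vb≡vj , va∈S) with proj₁ v-bij vb≡vj
    ...   | refl = from ∈B (inj₁ (c , va∈S))
    B⇒A : v a ∈ B v S j → v j ∈ A v S a
    B⇒A va∈B with to ∈B va∈B
    ... | inj₁ (q , va∈S) = from ∈A (inj₂ (q , j , refl , va∈S))
    ... | inj₂ (c , b , vc≡va , vj∈S) with proj₁ v-bij vc≡va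
    ...   | refl = from ∈A (inj₁ (b , vj∈S))

  D-via-B : ∀ c x → D c x ≡ lookup (B v S (u c)) x
  D-via-B c x =
    lookup-≡ (subst₂ (λ c′ x′ → c′ ∈ A v S (u x) ⇔ x′ ∈ B v S (u c)) (v∘u c) (v∘u x) A-B-duality)

  loopless : ConditionII v S → Loopless D
  loopless II x = ∉⇒lookup≡false (subst (_∉ A v S (u x)) (v∘u x) (v∉A (u x)))
    where
    v∉A : ∀ a → v a ∉ A v S a
    v∉A a va∈A with to ∈A va∈A
    ... | inj₁ (p , va∈S) = proj₁ (II a p) va∈S
    ... | inj₂ (c , b , vb≡va , va∈S) = proj₂ (II c b) (subst (_∈ S c b) (sym vb≡va) va∈S)

  isDoubleCompetition : {m : Multigraph n} → IsDoubleIndexedECP m S → ConditionI v S →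
                        IsDoubleCompetitionMultigraphOf m D
  isDoubleCompetition {m} (_ , partition) I x y x≢y = begin
    m x y                                     ≡⟨ partition x y x≢y ⟨
    pairCount S x y                           ≡⟨ pairCount-product S α β factor ⟩
    ∣ tabulate α ∣ * ∣ tabulate β ∣
      ≡⟨ cong₂ _*_ (∣tabulate∣-permute (flip π) α) (trans (cong ∣_∣ (tabulate-cong β∘u)) (∣tabulate∣-permute (flip π) β)) ⟨
    ∣ tabulate (λ c → D x c ∧ D y c) ∣ * ∣ tabulate (λ c → D c x ∧ D c y) ∣
                                              ≡⟨ ∣common-neighbours∣ D x y ⟨
    ∣ N⁺ D x ∩ N⁺ D y ∣ * ∣ N⁻ D x ∩ N⁻ D y ∣ ∎
    where
    open ≡-Reasoning
    α β : Fin n → Bool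
    α i = both (A v S i) x y
    β j = both (B v S j) x y
    factor : ∀ i j → both (S i j) x y ≡ α i ∧ β j
    factor i j = trans (both-determined x≢y S⊆A∩B (I i j)) (both-∩ (A v S i) (B v S j) x y)
    β∘u : ∀ c → D c x ∧ D c y ≡ β (u c)
    β∘u c = cong₂ _∧_ (D-via-B c x) (D-via-B c y)

theorem2p3 : (n : ℕ) (m : Multigraph n) → IsSymmetric m →
    (Σ[ D ∈ Digraph n ] (Loopless D × IsDoubleCompetitionMultigraphOf m D))
    ⇔
    (Σ[ v ∈ (Fin n → Fin n) ] Σ[ S ∈ (Fin n → Fin n → Subset n) ]
    (Bijective _≡_ _≡_ v × IsDoubleIndexedECP m S × ConditionI v S × ConditionII v S))
theorem2p3 n m _ = mk⇔
  (λ (D , loopless , dc) → FromDigraph.realises D dc loopless)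
  (λ (v , S , v-bij , ecp , I , II) →
     let open FromPartition v S v-bij in D , loopless II , isDoubleCompetition ecp I)
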